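{- Let $n=(3^h-1)/2$ be the number of nodes of the complete ternary tree $T_h$. The 1-2 drawing of $T_h$ constructed by using Construction 1 only, as well as the one constructed by using Construction 2 only, has width $O(n^{\log_3 2})$, height $O(n^{\log_3 2})$, and area $O(n^{\log_3 4})$.
   Context: $T_h$ denotes the complete ternary tree: every non-leaf node has exactly three children and every root-to-leaf path has exactly $h$ nodes. A drawing means a planar straight-line orthogonal grid drawing: nodes at distinct integer points, each edge a horizontal or vertical segment, no crossings; width (height) is the number of vertical (horizontal) grid lines intersecting it, area is width times height. Construction 1: given three drawings $\Gamma^a,\Gamma^b,\Gamma^c$ of $T_{h-1}$, place the root $r$ of $T_h$ at a grid point; translate $\Gamma^a$ so that its topmost grid row is one unit below $r$ and its root is on the vertical line through $r$; rotate $\Gamma^b$ clockwise by $90^\circ$ and place it so its rightmost grid column is one unit left of the leftmost column of $\Gamma^a$, its root on the horizontal line through $r$; rotate $\Gamma^c$ counterclockwise by $90^\circ$ and place it so its leftmost column is one unit right of the rightmost column of $\Gamma^a$, its root on the horizontal line through $r$; connect $r$ to the three roots. Construction 2: place $r$; rotate $\Gamma^b$ clockwise by $90^\circ$ and place it so its rightmost column is one unit left of $r$, its root on the horizontal line through $r$; rotate $\Gamma^c$ counterclockwise by $90^\circ$ and place it so its leftmost column is one unit right of $r$, its root on the horizontal line through $r$; place $\Gamma^a$ so its topmost row is one unit below the lowest row intersecting $\Gamma^b$ or $\Gamma^c$, its root on the vertical line through $r$; connect $r$ to the three roots. The drawing constructed by Construction $i$ only ($i\in\{1,2\}$) is defined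 by: $\Gamma_1$ is a single node at a grid point, and $\Gamma_h$ is obtained by Construction $i$ with $\Gamma^a,\Gamma^b,\Gamma^c$ all copies of $\Gamma_{h-1}$. -}

module Defs where

open import Data.Nat using (ℕ; zero; suc)
open import Data.Integer as ℤ using (ℤ; _+_; _-_; -_; _⊔_; _⊓_; ∣_∣)
open import Data.Product using (_×_; _,_; proj₁; proj₂)
open import Data.List using (List; []; _∷_; _++_; map; foldr)

-- Grid points (x , y); y grows upward ("below" = smaller y).
Point : Set
Point = ℤ × ℤ

-- A grid drawing: position of the root, positions of all nodes (the root
-- included), and the edges as pairs of endpoints (each a straight segment).
record Drawing : Set where
  constructor drawing
  field
    root  : Point
    nodes : List Point
    edges : List (Point × Point)
open Drawing public

xs ys : Drawing → List ℤ
xs d = map proj₁ (nodes d)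
ys d = map proj₂ (nodes d)

-- extreme coordinates of the node set (seeded with the root, which is a node)
leftmost rightmost bottommost topmost : Drawing → ℤ
leftmost   d = foldr _⊓_ (proj₁ (root d)) (xs d)
rightmost  d = foldr _⊔_ (proj₁ (root d)) (xs d)
bottommost d = foldr _⊓_ (proj₂ (root d)) (ys d)
topmost    d = foldr _⊔_ (proj₂ (root d)) (ys d)

-- number of vertical / horizontal grid lines intersecting the drawing
width height area : Drawing → ℕ
width  d = suc ∣ rightmost d - leftmost d ∣
height d = suc ∣ topmost d - bottommost d ∣
area   d = Data.Nat._*_ (width d) (height d)

mapPt : (Point → Point) → Drawing → Drawing
mapPt f (drawing r ns es) =
  drawing (f r) (map f ns) (map (λ e → f (proj₁ e) , f (proj₂ e)) es)

translate : ℤ → ℤ → Drawing → Drawing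
translate dx dy = mapPt (λ p → proj₁ p + dx , proj₂ p + dy)

rotCW rotCCW : Drawing → Drawing
rotCW  = mapPt (λ p → proj₂ p , - proj₁ p)
rotCCW = mapPt (λ p → - proj₂ p , proj₁ p)

join : Point → Drawing → Drawing → Drawing → Drawing
join r a b c = drawing r (r ∷ nodes a ++ nodes b ++ nodes c)
  ((r , root a) ∷ (r , root b) ∷ (r , root c) ∷ edges a ++ edges b ++ edges c)

private
  rx ry : Point → ℤ
  rx = proj₁
  ry = proj₂

construction1 : Point → Drawing → Drawing → Drawing → Drawing
construction1 r Γa Γb Γc = join r a b c
  where
  a = translate (rx r - rx (root Γa)) ((ry r - ℤ.1ℤ) - topmost Γa) Γa
  b₀ = rotCW Γb
  b = translate ((leftmost a - ℤ.1ℤ) - rightmost b₀) (ry r - ry (root b₀)) b₀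
  c₀ = rotCCW Γc
  c = translate ((rightmost a + ℤ.1ℤ) - leftmost c₀) (ry r - ry (root c₀)) c₀

construction2 : Point → Drawing → Drawing → Drawing → Drawing
construction2 r Γa Γb Γc = join r a b c
  where
  b₀ = rotCW Γb
  b = translate ((rx r - ℤ.1ℤ) - rightmost b₀) (ry r - ry (root b₀)) b₀
  c₀ = rotCCW Γc
  c = translate ((rx r + ℤ.1ℤ) - leftmost c₀) (ry r - ry (root c₀)) c₀
  a = translate (rx r - rx (root Γa))
        (((bottommost b ⊓ bottommost c) - ℤ.1ℤ) - topmost Γa) Γa

data Construction : Set where
  C1 C2 : Construction

construct : Construction → Point → Drawing → Drawing → Drawing → Drawing
construct C1 = construction1
construct C2 = construction2

origin : Point
origin = ℤ.0ℤ , ℤ.0ℤ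

single : Drawing
single = drawing origin (origin ∷ []) []

-- Γ i h : drawing of T_h built by Construction i only
-- (Γ i 1 is a single node; the h = 0 value is irrelevant, set to a single node)
Γ : Construction → ℕ → Drawing
Γ i zero = single
Γ i (suc zero) = single
Γ i (suc (suc k)) = construct i origin (Γ i (suc k)) (Γ i (suc k)) (Γ i (suc k))

-- Both constructions place the two rotated copies of the subdrawing on either side of a middle
-- column and the unrotated copy below, so every drawing is symmetric about its root's column.
-- Its bounding box is then described by a radius m (2m + 1 columns) and a vertical extent w
-- (w + 1 rows).  Reading off the placements, (m , w) becomes (m + 1 + w , m + 1 + w) under
-- Construction 1 and (w + 1 , 2m + 1 + w) under Construction 2, provided m ≤ w + 1, which both
-- recurrences preserve.  Either way m + w + 2 doubles at each level, so it equals 2^h; width and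
-- height are at most 2^(h+1) and the area at most 2·4^h, and 2^h, 4^h are Θ(n^(log₃ 2)),
-- Θ(n^(log₃ 4)) for n = (3^h − 1)/2.
module Submission where

open import Defs
open import Algebra.Core using (Op₂)
open import Algebra.Lattice.Structures using (IsSemilattice)
open import Data.Nat using (ℕ; zero; suc; _+_; _*_; _^_; _≤_; z≤n; s≤s)
import Data.Nat.Properties as ℕ
import Data.Nat.Tactic.RingSolver as ℕ-Solver
open import Data.Integer as ℤ using (ℤ; +_; -_; _⊓_; _⊔_; ∣_∣; 0ℤ; 1ℤ)
import Data.Integer.Properties as ℤ
open import Data.Integer.Tactic.RingSolver using (solve-∀)
open import Data.List using ([]; _∷_; _++_; map; foldr)
open import Data.List.Properties using (map-++; foldr-++; map-∘; map-cong)
open import Data.Product using (_×_; _,_; proj₁; proj₂; ∃-syntax)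
open import Relation.Binary.PropositionalEquality
  using (_≡_; refl; sym; trans; subst; cong; cong₂; module ≡-Reasoning)

module _ {A : Set} {_∙_ : Op₂ A} (isSemilattice : IsSemilattice _≡_ _∙_) where
  open IsSemilattice _≡_ isSemilattice using (assoc; comm; idem)

  foldr-seed : ∀ s t xs → foldr _∙_ (s ∙ t) xs ≡ foldr _∙_ s xs ∙ t
  foldr-seed s t []       = refl
  foldr-seed s t (x ∷ xs) = trans (cong (x ∙_) (foldr-seed s t xs)) (sym (assoc x _ t))

  foldr-∷-seed : ∀ x xs s → foldr _∙_ s (x ∷ xs) ≡ foldr _∙_ x (x ∷ xs) ∙ s
  foldr-∷-seed x xs s = sym (begin
    (x ∙ foldr _∙_ x xs) ∙ s ≡⟨ assoc x _ s ⟩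
    x ∙ (foldr _∙_ x xs ∙ s) ≡⟨ cong (x ∙_) (sym (foldr-seed x s xs)) ⟩
    x ∙ foldr _∙_ (x ∙ s) xs ≡⟨ cong (λ z → x ∙ foldr _∙_ z xs) (comm x s) ⟩
    x ∙ foldr _∙_ (s ∙ x) xs ≡⟨ cong (x ∙_) (foldr-seed s x xs) ⟩
    x ∙ (foldr _∙_ s xs ∙ x) ≡⟨ cong (x ∙_) (comm _ x) ⟩
    x ∙ (x ∙ foldr _∙_ s xs) ≡⟨ sym (assoc x x _) ⟩
    (x ∙ x) ∙ foldr _∙_ s xs ≡⟨ cong (_∙ foldr _∙_ s xs) (idem x) ⟩
    x ∙ foldr _∙_ s xs       ∎)
    where open ≡-Reasoning

  ∙-absorbs-repeat : ∀ x y → x ∙ (y ∙ x) ≡ x ∙ y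
  ∙-absorbs-repeat x y = begin
    x ∙ (y ∙ x) ≡⟨ cong (x ∙_) (comm y x) ⟩
    x ∙ (x ∙ y) ≡⟨ sym (assoc x x y) ⟩
    (x ∙ x) ∙ y ≡⟨ cong (_∙ y) (idem x) ⟩
    x ∙ y       ∎
    where open ≡-Reasoning

foldr-map-homo : ∀ {A B : Set} {_∙_ : Op₂ A} {_∘_ : Op₂ B} (h : A → B) →
  (∀ x y → h (x ∙ y) ≡ h x ∘ h y) → ∀ s xs → foldr _∘_ (h s) (map h xs) ≡ h (foldr _∙_ s xs)
foldr-map-homo h homo s []       = refl
foldr-map-homo {_∘_ = _∘_} h homo s (x ∷ xs) =
  trans (cong (h x ∘_) (foldr-map-homo h homo s xs)) (sym (homo x _))

-- leftmost d is extremum _⊓_ proj₁ d by definition, and likewise for the other three extremes.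
extremum : Op₂ ℤ → (Point → ℤ) → Drawing → ℤ
extremum _∙_ g d = foldr _∙_ (g (root d)) (map g (nodes d))

extremum-mapPt : ∀ {_∙_ _∘_ : Op₂ ℤ} (f : Point → Point) {g g′ : Point → ℤ} (h : ℤ → ℤ) →
  (∀ p → g (f p) ≡ h (g′ p)) → (∀ x y → h (x ∙ y) ≡ h x ∘ h y) →
  ∀ d → extremum _∘_ g (mapPt f d) ≡ h (extremum _∙_ g′ d)
extremum-mapPt {_∙_} {_∘_} f {g} {g′} h g∘f≗h∘g′ homo (drawing r ns es) = begin
  foldr _∘_ (g (f r)) (map g (map f ns))
    ≡⟨ cong₂ (foldr _∘_) (g∘f≗h∘g′ r) (trans (sym (map-∘ ns)) (map-cong g∘f≗h∘g′ ns)) ⟩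
  foldr _∘_ (h (g′ r)) (map (λ p → h (g′ p)) ns)
    ≡⟨ cong (foldr _∘_ (h (g′ r))) (map-∘ ns) ⟩
  foldr _∘_ (h (g′ r)) (map h (map g′ ns))
    ≡⟨ foldr-map-homo h homo (g′ r) (map g′ ns) ⟩
  h (foldr _∙_ (g′ r) (map g′ ns)) ∎
  where open ≡-Reasoning

data RootFirst : Drawing → Set where
  rootFirst : ∀ r ns es → RootFirst (drawing r (r ∷ ns) es)

module _ {_∙_ : Op₂ ℤ} (isSemilattice : IsSemilattice _≡_ _∙_) where
  open IsSemilattice _≡_ isSemilattice using (assoc)

  private
    E : (Point → ℤ) → Drawing → ℤ
    E = extremum _∙_

  foldr-rootFirst : ∀ g {d} → RootFirst d → ∀ s → foldr _∙_ s (map g (nodes d)) ≡ E g d ∙ s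
  foldr-rootFirst g (rootFirst r ns es) = foldr-∷-seed isSemilattice (g r) (map g ns)

  extremum-join : ∀ g p {a b c} → RootFirst a → RootFirst b → RootFirst c →
    E g (join p a b c) ≡ g p ∙ (E g a ∙ (E g b ∙ E g c))
  extremum-join g p {a} {b} {c} ra rb rc = begin
    g p ∙ foldr _∙_ (g p) (map g (nodes a ++ nodes b ++ nodes c))
      ≡⟨ cong (λ xs → g p ∙ foldr _∙_ (g p) xs) map-distrib ⟩
    g p ∙ foldr _∙_ (g p) (map g (nodes a) ++ map g (nodes b) ++ map g (nodes c))
      ≡⟨ cong (g p ∙_) fold-distrib ⟩
    g p ∙ (E g a ∙ (E g b ∙ (E g c ∙ g p)))
      ≡⟨ cong (g p ∙_) (trans (cong (E g a ∙_) (sym (assoc _ _ _))) (sym (assoc _ _ _))) ⟩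
    g p ∙ ((E g a ∙ (E g b ∙ E g c)) ∙ g p)
      ≡⟨ ∙-absorbs-repeat isSemilattice (g p) _ ⟩
    g p ∙ (E g a ∙ (E g b ∙ E g c)) ∎
    where
    open ≡-Reasoning
    map-distrib : map g (nodes a ++ nodes b ++ nodes c)
                ≡ map g (nodes a) ++ map g (nodes b) ++ map g (nodes c)
    map-distrib = trans (map-++ g (nodes a) _) (cong (map g (nodes a) ++_) (map-++ g (nodes b) _))
    fold-distrib : foldr _∙_ (g p) (map g (nodes a) ++ map g (nodes b) ++ map g (nodes c))
                 ≡ E g a ∙ (E g b ∙ (E g c ∙ g p))
    fold-distrib = begin
      foldr _∙_ (g p) (map g (nodes a) ++ map g (nodes b) ++ map g (nodes c))
        ≡⟨ foldr-++ _∙_ (g p) (map g (nodes a)) _ ⟩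
      foldr _∙_ (foldr _∙_ (g p) (map g (nodes b) ++ map g (nodes c))) (map g (nodes a))
        ≡⟨ foldr-rootFirst g ra _ ⟩
      E g a ∙ foldr _∙_ (g p) (map g (nodes b) ++ map g (nodes c))
        ≡⟨ cong (E g a ∙_) (trans (foldr-++ _∙_ (g p) (map g (nodes b)) _) (foldr-rootFirst g rb _)) ⟩
      E g a ∙ (E g b ∙ foldr _∙_ (g p) (map g (nodes c)))
        ≡⟨ cong (λ z → E g a ∙ (E g b ∙ z)) (foldr-rootFirst g rc _) ⟩
      E g a ∙ (E g b ∙ (E g c ∙ g p)) ∎

record Interval : Set where
  constructor [_,_]
  field
    lo hi : ℤ
open Interval

_∪_ : Interval → Interval → Interval
I ∪ J = [ lo I ⊓ lo J , hi I ⊔ hi J ]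

_⊆_ _≼_ : Interval → Interval → Set
I ⊆ J = lo J ℤ.≤ lo I × hi I ℤ.≤ hi J
I ≼ J = lo I ℤ.≤ lo J × hi I ℤ.≤ hi J

point : ℤ → Interval
point x = [ x , x ]

centred : ℕ → Interval
centred m = [ - + m , + m ]

shift : ℤ → Interval → Interval
shift k I = [ lo I ℤ.+ k , hi I ℤ.+ k ]

mirror : Interval → Interval
mirror I = [ - hi I , - lo I ]

length : Interval → ℕ
length I = ∣ hi I ℤ.- lo I ∣

∪-idem : ∀ I → I ∪ I ≡ I
∪-idem I = cong₂ [_,_] (ℤ.⊓-idem (lo I)) (ℤ.⊔-idem (hi I))

⊆⇒∪≡ : ∀ {I J} → I ⊆ J → I ∪ J ≡ J
⊆⇒∪≡ (lo≤ , ≤hi) = cong₂ [_,_] (ℤ.i≥j⇒i⊓j≡j lo≤) (ℤ.i≤j⇒i⊔j≡j ≤hi)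

≼⇒∪≡ : ∀ {I J} → I ≼ J → I ∪ J ≡ [ lo I , hi J ]
≼⇒∪≡ (lo≤ , hi≤) = cong₂ [_,_] (ℤ.i≤j⇒i⊓j≡i lo≤) (ℤ.i≤j⇒i⊔j≡j hi≤)

centred-⊆ : ∀ {m n} → m ≤ n → centred m ⊆ centred n
centred-⊆ m≤n = ℤ.neg-mono-≤ (ℤ.+≤+ m≤n) , ℤ.+≤+ m≤n

shift-zero : ∀ I → shift 0ℤ I ≡ I
shift-zero I = cong₂ [_,_] (ℤ.+-identityʳ (lo I)) (ℤ.+-identityʳ (hi I))

mirror-centred : ∀ m → mirror (centred m) ≡ centred m
mirror-centred m = cong [ - + m ,_] (ℤ.neg-involutive (+ m))

length-straddling : ∀ a b → length [ - + b , + a ] ≡ a + b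
length-straddling a b = cong ∣_∣ (cong (λ x → + a ℤ.+ x) (ℤ.neg-involutive (+ b)))

span : (Point → ℤ) → Drawing → Interval
span g d = [ extremum _⊓_ g d , extremum _⊔_ g d ]

xSpan ySpan : Drawing → Interval
xSpan = span proj₁
ySpan = span proj₂

private
  translate-homo-⊓ : ∀ k x y → (x ⊓ y) ℤ.+ k ≡ (x ℤ.+ k) ⊓ (y ℤ.+ k)
  translate-homo-⊓ k = ℤ.mono-≤-distrib-⊓ (ℤ.+-monoˡ-≤ k)

  translate-homo-⊔ : ∀ k x y → (x ⊔ y) ℤ.+ k ≡ (x ℤ.+ k) ⊔ (y ℤ.+ k)
  translate-homo-⊔ k = ℤ.mono-≤-distrib-⊔ (ℤ.+-monoˡ-≤ k)

xSpan-translate : ∀ dx dy d → xSpan (translate dx dy d) ≡ shift dx (xSpan d)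
xSpan-translate dx dy d = cong₂ [_,_]
  (extremum-mapPt _ (λ x → x ℤ.+ dx) (λ _ → refl) (translate-homo-⊓ dx) d)
  (extremum-mapPt _ (λ x → x ℤ.+ dx) (λ _ → refl) (translate-homo-⊔ dx) d)

ySpan-translate : ∀ dx dy d → ySpan (translate dx dy d) ≡ shift dy (ySpan d)
ySpan-translate dx dy d = cong₂ [_,_]
  (extremum-mapPt _ (λ y → y ℤ.+ dy) (λ _ → refl) (translate-homo-⊓ dy) d)
  (extremum-mapPt _ (λ y → y ℤ.+ dy) (λ _ → refl) (translate-homo-⊔ dy) d)

xSpan-rotCW : ∀ d → xSpan (rotCW d) ≡ ySpan d
xSpan-rotCW d = cong₂ [_,_]
  (extremum-mapPt {_⊓_} _ (λ x → x) (λ _ → refl) (λ _ _ → refl) d)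
  (extremum-mapPt {_⊔_} _ (λ x → x) (λ _ → refl) (λ _ _ → refl) d)

ySpan-rotCW : ∀ d → ySpan (rotCW d) ≡ mirror (xSpan d)
ySpan-rotCW d = cong₂ [_,_]
  (extremum-mapPt _ -_ (λ _ → refl) ℤ.neg-distrib-⊔-⊓ d)
  (extremum-mapPt _ -_ (λ _ → refl) ℤ.neg-distrib-⊓-⊔ d)

xSpan-rotCCW : ∀ d → xSpan (rotCCW d) ≡ mirror (ySpan d)
xSpan-rotCCW d = cong₂ [_,_]
  (extremum-mapPt _ -_ (λ _ → refl) ℤ.neg-distrib-⊔-⊓ d)
  (extremum-mapPt _ -_ (λ _ → refl) ℤ.neg-distrib-⊓-⊔ d)

ySpan-rotCCW : ∀ d → ySpan (rotCCW d) ≡ xSpan d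
ySpan-rotCCW d = cong₂ [_,_]
  (extremum-mapPt {_⊓_} _ (λ y → y) (λ _ → refl) (λ _ _ → refl) d)
  (extremum-mapPt {_⊔_} _ (λ y → y) (λ _ → refl) (λ _ _ → refl) d)

span-join : ∀ g p {a b c} → RootFirst a → RootFirst b → RootFirst c →
  span g (join p a b c) ≡ point (g p) ∪ (span g a ∪ (span g b ∪ span g c))
span-join g p ra rb rc = cong₂ [_,_]
  (extremum-join ℤ.⊓-isSemilattice g p ra rb rc)
  (extremum-join ℤ.⊔-isSemilattice g p ra rb rc)

abut-left : ∀ m a b →
  shift ((- + m ℤ.- 1ℤ) ℤ.- + a) [ - + b , + a ] ≡ [ - + (m + 1 + (a + b)) , - + (m + 1) ]
abut-left m a b = cong₂ [_,_] (lo≡ (+ b) (+ m) (+ a)) (hi≡ (+ m) (+ a))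
  where
  lo≡ : ∀ B M A → - B ℤ.+ ((- M ℤ.- 1ℤ) ℤ.- A) ≡ - (M ℤ.+ 1ℤ ℤ.+ (A ℤ.+ B))
  lo≡ = solve-∀
  hi≡ : ∀ M A → A ℤ.+ ((- M ℤ.- 1ℤ) ℤ.- A) ≡ - (M ℤ.+ 1ℤ)
  hi≡ = solve-∀

abut-right : ∀ m a b →
  shift ((+ m ℤ.+ 1ℤ) ℤ.- - + a) (mirror [ - + b , + a ]) ≡ [ + (m + 1) , + (m + 1 + (a + b)) ]
abut-right m a b = cong₂ [_,_] (lo≡ (+ m) (+ a)) (hi≡ (+ m) (+ a) (+ b))
  where
  lo≡ : ∀ M A → - A ℤ.+ ((M ℤ.+ 1ℤ) ℤ.- - A) ≡ M ℤ.+ 1ℤ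
  lo≡ = solve-∀
  hi≡ : ∀ M A B → - - B ℤ.+ ((M ℤ.+ 1ℤ) ℤ.- - A) ≡ M ℤ.+ 1ℤ ℤ.+ (A ℤ.+ B)
  hi≡ = solve-∀

hull-flanked : ∀ {m r} s → m ≤ r →
  point 0ℤ ∪ (centred m ∪ ([ - + r , - + s ] ∪ [ + s , + r ])) ≡ centred r
hull-flanked {m} {r} s m≤r = begin
  point 0ℤ ∪ (centred m ∪ ([ - + r , - + s ] ∪ [ + s , + r ]))
    ≡⟨ cong (λ I → point 0ℤ ∪ (centred m ∪ I)) (≼⇒∪≡ (ℤ.neg-≤-pos , ℤ.neg-≤-pos)) ⟩
  point 0ℤ ∪ (centred m ∪ centred r)
    ≡⟨ cong (point 0ℤ ∪_) (⊆⇒∪≡ (centred-⊆ m≤r)) ⟩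
  centred 0 ∪ centred r
    ≡⟨ ⊆⇒∪≡ (centred-⊆ z≤n) ⟩
  centred r ∎
  where open ≡-Reasoning

hull-hanging : ∀ {m r} s → m ≤ r →
  point 0ℤ ∪ ([ - + r , - + s ] ∪ (centred m ∪ centred m)) ≡ [ - + r , + m ]
hull-hanging {m} {r} s m≤r = begin
  point 0ℤ ∪ ([ - + r , - + s ] ∪ (centred m ∪ centred m))
    ≡⟨ cong (λ I → point 0ℤ ∪ ([ - + r , - + s ] ∪ I)) (∪-idem (centred m)) ⟩
  point 0ℤ ∪ ([ - + r , - + s ] ∪ centred m)
    ≡⟨ cong (point 0ℤ ∪_) (≼⇒∪≡ (ℤ.neg-mono-≤ (ℤ.+≤+ m≤r) , ℤ.neg-≤-pos)) ⟩
  point 0ℤ ∪ [ - + r , + m ]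
    ≡⟨ ⊆⇒∪≡ (ℤ.neg-≤-pos , ℤ.+≤+ z≤n) ⟩
  [ - + r , + m ] ∎
  where open ≡-Reasoning

record Shape (d : Drawing) (mw : ℕ × ℕ) : Set where
  constructor shape
  field
    xSpan≡      : xSpan d ≡ centred (proj₁ mw)
    above below : ℕ
    height≡     : above + below ≡ proj₂ mw
    ySpan≡      : ySpan d ≡ [ - + below , + above ]

data AtOrigin : Drawing → Set where
  atOrigin : ∀ ns es → AtOrigin (drawing origin (origin ∷ ns) es)

grow : Construction → ℕ × ℕ → ℕ × ℕ
grow C1 (m , w) = m + 1 + w , m + suc w
grow C2 (m , w) = suc w , m + (m + 1 + w)

private
  xSpan-translate-vertically : ∀ {d m} dy → xSpan d ≡ centred m → xSpan (translate 0ℤ dy d) ≡ centred m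
  xSpan-translate-vertically {d} dy xd = trans (xSpan-translate 0ℤ dy d) (trans (shift-zero _) xd)

  ySpan-rotCW-centred : ∀ {d m} dx → xSpan d ≡ centred m → ySpan (translate dx 0ℤ (rotCW d)) ≡ centred m
  ySpan-rotCW-centred {d} {m} dx xd = begin
    ySpan (translate dx 0ℤ (rotCW d)) ≡⟨ ySpan-translate dx 0ℤ (rotCW d) ⟩
    shift 0ℤ (ySpan (rotCW d))        ≡⟨ shift-zero _ ⟩
    ySpan (rotCW d)                   ≡⟨ ySpan-rotCW d ⟩
    mirror (xSpan d)                  ≡⟨ cong mirror xd ⟩
    mirror (centred m)                ≡⟨ mirror-centred m ⟩
    centred m                         ∎
    where open ≡-Reasoning

  ySpan-rotCCW-centred : ∀ {d m} dx → xSpan d ≡ centred m → ySpan (translate dx 0ℤ (rotCCW d)) ≡ centred m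
  ySpan-rotCCW-centred {d} dx xd =
    trans (ySpan-translate dx 0ℤ (rotCCW d)) (trans (shift-zero _) (trans (ySpan-rotCCW d) xd))

  m≤m+1+w : ∀ m w → m ≤ m + 1 + w
  m≤m+1+w m w = ℕ.m≤n⇒m≤n+o w (ℕ.m≤m+n m 1)

shape-construction1 : ∀ {G m w} → AtOrigin G → Shape G (m , w) → m ≤ suc w →
  Shape (construction1 origin G G G) (grow C1 (m , w))
shape-construction1 {m = m} (atOrigin ns es) (shape xG a b refl yG) m≤1+w =
  shape x≡ m (suc (a + b)) refl y≡
  where
  open ≡-Reasoning
  G = drawing origin (origin ∷ ns) es
  A = translate 0ℤ ((0ℤ ℤ.- 1ℤ) ℤ.- topmost G) G
  B = translate ((leftmost A ℤ.- 1ℤ) ℤ.- rightmost (rotCW G)) 0ℤ (rotCW G)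
  C = translate ((rightmost A ℤ.+ 1ℤ) ℤ.- leftmost (rotCCW G)) 0ℤ (rotCCW G)

  xA : xSpan A ≡ centred m
  xA = xSpan-translate-vertically {G} _ xG

  xB : xSpan B ≡ [ - + (m + 1 + (a + b)) , - + (m + 1) ]
  xB = begin
    xSpan B
      ≡⟨ xSpan-translate _ 0ℤ (rotCW G) ⟩
    shift ((lo (xSpan A) ℤ.- 1ℤ) ℤ.- hi (xSpan (rotCW G))) (xSpan (rotCW G))
      ≡⟨ cong₂ (λ I J → shift ((lo I ℤ.- 1ℤ) ℤ.- hi J) J) xA (trans (xSpan-rotCW G) yG) ⟩
    shift ((- + m ℤ.- 1ℤ) ℤ.- + a) [ - + b , + a ]
      ≡⟨ abut-left m a b ⟩
    [ - + (m + 1 + (a + b)) , - + (m + 1) ] ∎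

  xC : xSpan C ≡ [ + (m + 1) , + (m + 1 + (a + b)) ]
  xC = begin
    xSpan C
      ≡⟨ xSpan-translate _ 0ℤ (rotCCW G) ⟩
    shift ((hi (xSpan A) ℤ.+ 1ℤ) ℤ.- lo (xSpan (rotCCW G))) (xSpan (rotCCW G))
      ≡⟨ cong₂ (λ I J → shift ((hi I ℤ.+ 1ℤ) ℤ.- lo J) J) xA
           (trans (xSpan-rotCCW G) (cong mirror yG)) ⟩
    shift ((+ m ℤ.+ 1ℤ) ℤ.- - + a) (mirror [ - + b , + a ])
      ≡⟨ abut-right m a b ⟩
    [ + (m + 1) , + (m + 1 + (a + b)) ] ∎

  yA : ySpan A ≡ [ - + suc (a + b) , - + 1 ]
  yA = begin
    ySpan A
      ≡⟨ ySpan-translate 0ℤ _ G ⟩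
    shift ((0ℤ ℤ.- 1ℤ) ℤ.- hi (ySpan G)) (ySpan G)
      ≡⟨ cong (λ I → shift ((0ℤ ℤ.- 1ℤ) ℤ.- hi I) I) yG ⟩
    shift ((- + 0 ℤ.- 1ℤ) ℤ.- + a) [ - + b , + a ]
      ≡⟨ abut-left 0 a b ⟩
    [ - + suc (a + b) , - + 1 ] ∎

  x≡ : xSpan (construction1 origin G G G) ≡ centred (m + 1 + (a + b))
  x≡ = begin
    xSpan (join origin A B C)
      ≡⟨ span-join proj₁ origin {A} {B} {C} (rootFirst _ _ _) (rootFirst _ _ _) (rootFirst _ _ _) ⟩
    point 0ℤ ∪ (xSpan A ∪ (xSpan B ∪ xSpan C))
      ≡⟨ cong₂ (λ I J → point 0ℤ ∪ (I ∪ J)) xA (cong₂ _∪_ xB xC) ⟩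
    point 0ℤ ∪ (centred m ∪ ([ - + (m + 1 + (a + b)) , - + (m + 1) ]
                           ∪ [ + (m + 1) , + (m + 1 + (a + b)) ]))
      ≡⟨ hull-flanked (m + 1) (m≤m+1+w m (a + b)) ⟩
    centred (m + 1 + (a + b)) ∎

  y≡ : ySpan (construction1 origin G G G) ≡ [ - + suc (a + b) , + m ]
  y≡ = begin
    ySpan (join origin A B C)
      ≡⟨ span-join proj₂ origin {A} {B} {C} (rootFirst _ _ _) (rootFirst _ _ _) (rootFirst _ _ _) ⟩
    point 0ℤ ∪ (ySpan A ∪ (ySpan B ∪ ySpan C))
      ≡⟨ cong₂ (λ I J → point 0ℤ ∪ (I ∪ J)) yA
           (cong₂ _∪_ (ySpan-rotCW-centred {G} _ xG) (ySpan-rotCCW-centred {G} _ xG)) ⟩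
    point 0ℤ ∪ ([ - + suc (a + b) , - + 1 ] ∪ (centred m ∪ centred m))
      ≡⟨ hull-hanging 1 m≤1+w ⟩
    [ - + suc (a + b) , + m ] ∎

shape-construction2 : ∀ {G m w} → AtOrigin G → Shape G (m , w) → m ≤ suc w →
  Shape (construction2 origin G G G) (grow C2 (m , w))
shape-construction2 {m = m} (atOrigin ns es) (shape xG a b refl yG) m≤1+w =
  shape x≡ m (m + 1 + (a + b)) refl y≡
  where
  open ≡-Reasoning
  G = drawing origin (origin ∷ ns) es
  B = translate ((0ℤ ℤ.- 1ℤ) ℤ.- rightmost (rotCW G)) 0ℤ (rotCW G)
  C = translate ((0ℤ ℤ.+ 1ℤ) ℤ.- leftmost (rotCCW G)) 0ℤ (rotCCW G)
  A = translate 0ℤ (((bottommost B ⊓ bottommost C) ℤ.- 1ℤ) ℤ.- topmost G) G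

  xB : xSpan B ≡ [ - + suc (a + b) , - + 1 ]
  xB = begin
    xSpan B
      ≡⟨ xSpan-translate _ 0ℤ (rotCW G) ⟩
    shift ((0ℤ ℤ.- 1ℤ) ℤ.- hi (xSpan (rotCW G))) (xSpan (rotCW G))
      ≡⟨ cong (λ J → shift ((0ℤ ℤ.- 1ℤ) ℤ.- hi J) J) (trans (xSpan-rotCW G) yG) ⟩
    shift ((- + 0 ℤ.- 1ℤ) ℤ.- + a) [ - + b , + a ]
      ≡⟨ abut-left 0 a b ⟩
    [ - + suc (a + b) , - + 1 ] ∎

  xC : xSpan C ≡ [ + 1 , + suc (a + b) ]
  xC = begin
    xSpan C
      ≡⟨ xSpan-translate _ 0ℤ (rotCCW G) ⟩
    shift ((0ℤ ℤ.+ 1ℤ) ℤ.- lo (xSpan (rotCCW G))) (xSpan (rotCCW G))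
      ≡⟨ cong (λ J → shift ((0ℤ ℤ.+ 1ℤ) ℤ.- lo J) J) (trans (xSpan-rotCCW G) (cong mirror yG)) ⟩
    shift ((+ 0 ℤ.+ 1ℤ) ℤ.- - + a) (mirror [ - + b , + a ])
      ≡⟨ abut-right 0 a b ⟩
    [ + 1 , + suc (a + b) ] ∎

  yB : ySpan B ≡ centred m
  yB = ySpan-rotCW-centred {G} _ xG

  yC : ySpan C ≡ centred m
  yC = ySpan-rotCCW-centred {G} _ xG

  yA : ySpan A ≡ [ - + (m + 1 + (a + b)) , - + (m + 1) ]
  yA = begin
    ySpan A
      ≡⟨ ySpan-translate 0ℤ _ G ⟩
    shift (((lo (ySpan B) ⊓ lo (ySpan C)) ℤ.- 1ℤ) ℤ.- hi (ySpan G)) (ySpan G)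
      ≡⟨ cong₂ (λ k I → shift ((k ℤ.- 1ℤ) ℤ.- hi I) I)
           (trans (cong₂ (λ I J → lo I ⊓ lo J) yB yC) (ℤ.⊓-idem (- + m))) yG ⟩
    shift ((- + m ℤ.- 1ℤ) ℤ.- + a) [ - + b , + a ]
      ≡⟨ abut-left m a b ⟩
    [ - + (m + 1 + (a + b)) , - + (m + 1) ] ∎

  x≡ : xSpan (construction2 origin G G G) ≡ centred (suc (a + b))
  x≡ = begin
    xSpan (join origin A B C)
      ≡⟨ span-join proj₁ origin {A} {B} {C} (rootFirst _ _ _) (rootFirst _ _ _) (rootFirst _ _ _) ⟩
    point 0ℤ ∪ (xSpan A ∪ (xSpan B ∪ xSpan C))
      ≡⟨ cong₂ (λ I J → point 0ℤ ∪ (I ∪ J)) (xSpan-translate-vertically {G} _ xG) (cong₂ _∪_ xB xC) ⟩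
    point 0ℤ ∪ (centred m ∪ ([ - + suc (a + b) , - + 1 ] ∪ [ + 1 , + suc (a + b) ]))
      ≡⟨ hull-flanked 1 m≤1+w ⟩
    centred (suc (a + b)) ∎

  y≡ : ySpan (construction2 origin G G G) ≡ [ - + (m + 1 + (a + b)) , + m ]
  y≡ = begin
    ySpan (join origin A B C)
      ≡⟨ span-join proj₂ origin {A} {B} {C} (rootFirst _ _ _) (rootFirst _ _ _) (rootFirst _ _ _) ⟩
    point 0ℤ ∪ (ySpan A ∪ (ySpan B ∪ ySpan C))
      ≡⟨ cong₂ (λ I J → point 0ℤ ∪ (I ∪ J)) yA (cong₂ _∪_ yB yC) ⟩
    point 0ℤ ∪ ([ - + (m + 1 + (a + b)) , - + (m + 1) ] ∪ (centred m ∪ centred m))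
      ≡⟨ hull-hanging (m + 1) (m≤m+1+w m (a + b)) ⟩
    [ - + (m + 1 + (a + b)) , + m ] ∎

shape-construct : ∀ i {G e} → AtOrigin G → Shape G e → proj₁ e ≤ suc (proj₂ e) →
  Shape (construct i origin G G G) (grow i e)
shape-construct C1 = shape-construction1
shape-construct C2 = shape-construction2

extents : Construction → ℕ → ℕ × ℕ
extents i zero          = 0 , 0
extents i (suc zero)    = 0 , 0
extents i (suc (suc h)) = grow i (extents i (suc h))

size : ℕ × ℕ → ℕ
size (m , w) = m + w + 2

grow-size : ∀ i e → size (grow i e) ≡ 2 * size e
grow-size C1 (m , w) = doubling m w
  where
  doubling : ∀ m w → m + 1 + w + (m + suc w) + 2 ≡ 2 * (m + w + 2)
  doubling = ℕ-Solver.solve-∀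
grow-size C2 (m , w) = doubling m w
  where
  doubling : ∀ m w → suc w + (m + (m + 1 + w)) + 2 ≡ 2 * (m + w + 2)
  doubling = ℕ-Solver.solve-∀

grow-balanced : ∀ i e → proj₁ (grow i e) ≤ suc (proj₂ (grow i e))
grow-balanced C1 (m , w) = ℕ.m≤n⇒m≤1+n (ℕ.≤-reflexive (ℕ.+-assoc m 1 w))
grow-balanced C2 (m , w) = s≤s (ℕ.m≤n⇒m≤o+n m (ℕ.m≤n+m w (m + 1)))

extents-balanced : ∀ i h → proj₁ (extents i h) ≤ suc (proj₂ (extents i h))
extents-balanced i zero          = z≤n
extents-balanced i (suc zero)    = z≤n
extents-balanced i (suc (suc h)) = grow-balanced i (extents i (suc h))

extents-size : ∀ i h → size (extents i (suc h)) ≡ 2 ^ suc h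
extents-size i zero    = refl
extents-size i (suc h) = trans (grow-size i (extents i (suc h))) (cong (2 *_) (extents-size i h))

Γ-atOrigin : ∀ i h → AtOrigin (Γ i h)
Γ-atOrigin i  zero          = atOrigin [] []
Γ-atOrigin i  (suc zero)    = atOrigin [] []
Γ-atOrigin C1 (suc (suc h)) = atOrigin _ _
Γ-atOrigin C2 (suc (suc h)) = atOrigin _ _

Γ-shape : ∀ i h → Shape (Γ i h) (extents i h)
Γ-shape i zero          = shape refl 0 0 refl refl
Γ-shape i (suc zero)    = shape refl 0 0 refl refl
Γ-shape i (suc (suc h)) =
  shape-construct i (Γ-atOrigin i (suc h)) (Γ-shape i (suc h)) (extents-balanced i (suc h))

shape-bounds : ∀ {d} e → Shape d e → width d ≤ 2 * size e × height d ≤ size e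
shape-bounds {d} (m , w) (shape xSpan≡ above below height≡ ySpan≡) = width≤ , height≤
  where
  open ℕ.≤-Reasoning
  width≤ : width d ≤ 2 * (m + w + 2)
  width≤ = begin
    width d                   ≡⟨ cong (λ I → suc (length I)) xSpan≡ ⟩
    suc (length (centred m))  ≡⟨ cong suc (length-straddling m m) ⟩
    suc (m + m)               ≤⟨ ℕ.m≤m+n _ (w + w + 3) ⟩
    suc (m + m) + (w + w + 3) ≡⟨ rearrange m w ⟩
    2 * (m + w + 2)           ∎
    where
    rearrange : ∀ m w → suc (m + m) + (w + w + 3) ≡ 2 * (m + w + 2)
    rearrange = ℕ-Solver.solve-∀
  height≤ : height d ≤ m + w + 2
  height≤ = begin
    height d                             ≡⟨ cong (λ I → suc (length I)) ySpan≡ ⟩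
    suc (length [ - + below , + above ]) ≡⟨ cong suc (length-straddling above below) ⟩
    suc (above + below)                  ≡⟨ cong suc height≡ ⟩
    suc w                                ≤⟨ ℕ.m≤n+m (suc w) (m + 1) ⟩
    m + 1 + suc w                        ≡⟨ rearrange m w ⟩
    m + w + 2                            ∎
    where
    rearrange : ∀ m w → m + 1 + suc w ≡ m + w + 2
    rearrange = ℕ-Solver.solve-∀

4^n≡2^n*2^n : ∀ n → 4 ^ n ≡ 2 ^ n * 2 ^ n
4^n≡2^n*2^n n = begin
  (2 ^ 2) ^ n     ≡⟨ ℕ.^-*-assoc 2 2 n ⟩
  2 ^ (2 * n)     ≡⟨ cong (λ k → 2 ^ (n + k)) (ℕ.+-identityʳ n) ⟩
  2 ^ (n + n)     ≡⟨ ℕ.^-distribˡ-+-* 2 n n ⟩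
  2 ^ n * 2 ^ n   ∎
  where open ≡-Reasoning

Γ-dimensions : ∀ i h → width (Γ i (suc h)) ≤ 2 * 2 ^ suc h × height (Γ i (suc h)) ≤ 2 ^ suc h
Γ-dimensions i h = subst (λ n → width (Γ i (suc h)) ≤ 2 * n × height (Γ i (suc h)) ≤ n)
  (extents-size i h) (shape-bounds (extents i (suc h)) (Γ-shape i (suc h)))

area-bound : ∀ {d} n → width d ≤ 2 * 2 ^ n → height d ≤ 2 ^ n → area d ≤ 2 * 4 ^ n
area-bound {d} n width≤ height≤ = begin
  width d * height d      ≤⟨ ℕ.*-mono-≤ width≤ height≤ ⟩
  2 * 2 ^ n * 2 ^ n       ≡⟨ ℕ.*-assoc 2 (2 ^ n) (2 ^ n) ⟩
  2 * (2 ^ n * 2 ^ n)     ≡⟨ cong (2 *_) (sym (4^n≡2^n*2^n n)) ⟩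
  2 * 4 ^ n               ∎
  where open ℕ.≤-Reasoning

corollary1 : (i : Construction) →
    ∃[ c ] ∃[ h₀ ] ∀ (h : ℕ) → h₀ ≤ h →
    (width (Γ i h) ≤ c * 2 ^ h) × (height (Γ i h) ≤ c * 2 ^ h) × (area (Γ i h) ≤ c * 4 ^ h)
corollary1 i = 2 , 1 , λ where
  (suc h) _ → let width≤ , height≤ = Γ-dimensions i h in
    width≤ , ℕ.≤-trans height≤ (ℕ.m≤n*m _ 2) , area-bound {Γ i (suc h)} (suc h) width≤ height≤
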